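{- Let $T$ be a triangle in a quasi-thin scheme $(\Omega,S)$. Then $T$ is exceptional if and only if the set $\{1_\Omega\}\cup T^\perp$ is a subgroup of the group $S_1$ (under relational product) isomorphic to the Klein four-group.
   Context: A scheme is a pair $(\Omega,S)$ with $\Omega$ finite, $S$ a partition of $\Omega\times\Omega$ with $1_\Omega\in S$, $S$ closed under transposition $r\mapsto r^*$, and $|\alpha u\cap\gamma v^*|$ independent of $(\alpha,\gamma)\in w$ for $u,v,w\in S$. Quasi-thin: every basic relation $u$ has valency $|\alpha u|\in\{1,2\}$; $S_m$ is the set of basic relations of valency $m$; $S_1$ is a group under relational product $\cdot$. For $u,v\in S$, $uv$ is the set of basic relations contained in $u\cdot v$. For $u\in S_2$ there is a unique basic relation $u^\perp$ with $uu^*=\{1_\Omega,u^\perp\}$; for $T\subseteq S_2$, $T^\perp=\{u^\perp:u\in T\}$. Distinct $u,v\in S_2$ are adjacent if $|u^*v|=2$; a triangle is a $3$-subset of $S_2$ any two distinct elements of which are adjacent. A triangle $\{u,v,w\}$ is exceptional if $u^\perp\cdot v^\perp\cdot w^\perp=1_\Omega$. -}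

module Defs where

open import Data.Nat using (ℕ; zero; suc; _+_)
open import Data.Bool using (Bool; true; false; _∧_; _xor_; if_then_else_)
open import Data.Fin using (Fin; zero; suc; _≟_)
open import Data.Product using (Σ; ∃; ∃-syntax; _×_; _,_)
open import Data.Sum using (_⊎_)
open import Relation.Nullary using (¬_)
open import Relation.Nullary.Decidable using (⌊_⌋)
open import Relation.Binary.PropositionalEquality using (_≡_; _≢_)

cnt : ∀ {n} → (Fin n → Bool) → ℕ
cnt {zero}  P = 0
cnt {suc n} P = (if P zero then 1 else 0) + cnt (λ i → P (suc i))

-- A scheme on Ω = Fin n whose basic relations are indexed by Fin k:
-- the partition S of Ω×Ω is given by the colouring c (pair (α,β) lies in
-- basic relation c α β); every class is nonempty.
record Scheme : Set where
  field
    n k     : ℕ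
    c       : Fin n → Fin n → Fin k
    nonempty : ∀ (i : Fin k) → ∃[ α ] ∃[ β ] c α β ≡ i
    -- 1_Ω ∈ S : basic relation e is the diagonal
    e       : Fin k
    diag    : ∀ α β → (c α β ≡ e → α ≡ β) × (α ≡ β → c α β ≡ e)
    star    : Fin k → Fin k
    transp  : ∀ i α β → (c α β ≡ i → c β α ≡ star i) × (c β α ≡ star i → c α β ≡ i)
    -- intersection numbers: |αu ∩ γv*| depends only on the basic relation containing (α,γ)
    regular : ∀ (u v w : Fin k) (α γ α' γ' : Fin n) → c α γ ≡ w → c α' γ' ≡ w →
              cnt (λ δ → ⌊ c α δ ≟ u ⌋ ∧ ⌊ c δ γ ≟ v ⌋)
                ≡ cnt (λ δ → ⌊ c α' δ ≟ u ⌋ ∧ ⌊ c δ γ' ≟ v ⌋)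

module _ (S : Scheme) where
  open Scheme S

  valency : Fin k → Fin n → ℕ
  valency u α = cnt (λ δ → ⌊ c α δ ≟ u ⌋)

  QuasiThin : Set
  QuasiThin = ∀ (u : Fin k) (α : Fin n) → (valency u α ≡ 1) ⊎ (valency u α ≡ 2)

  InS : ℕ → Fin k → Set
  InS m u = ∀ (α : Fin n) → valency u α ≡ m

  -- x ∈ uv : basic relation x is contained in the relational product u·v
  InProd : Fin k → Fin k → Fin k → Set
  InProd u v x = ∀ α γ → c α γ ≡ x → ∃[ δ ] (c α δ ≡ u × c δ γ ≡ v)

  ProdIs : Fin k → Fin k → Fin k → Set
  ProdIs u v w = ∀ α γ → (∃[ δ ] (c α δ ≡ u × c δ γ ≡ v) → c α γ ≡ w)
                       × (c α γ ≡ w → ∃[ δ ] (c α δ ≡ u × c δ γ ≡ v))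

  Prod3IsId : Fin k → Fin k → Fin k → Set
  Prod3IsId u v w = ∀ α γ →
    (∃[ δ ] ∃[ ε ] (c α δ ≡ u × c δ ε ≡ v × c ε γ ≡ w) → α ≡ γ)
    × (α ≡ γ → ∃[ δ ] ∃[ ε ] (c α δ ≡ u × c δ ε ≡ v × c ε γ ≡ w))

  IsPerp : Fin k → Fin k → Set
  IsPerp u p = ∀ x → (InProd u (star u) x → (x ≡ e ⊎ x ≡ p))
                   × ((x ≡ e ⊎ x ≡ p) → InProd u (star u) x)

  Size2 : Fin k → Fin k → Set
  Size2 u v = ∃[ x ] ∃[ y ] (x ≢ y × InProd u v x × InProd u v y
                × (∀ z → InProd u v z → z ≡ x ⊎ z ≡ y))

  Adjacent : Fin k → Fin k → Set
  Adjacent u v = u ≢ v × Size2 (star u) v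

  Triangle : Fin k → Fin k → Fin k → Set
  Triangle u v w = InS 2 u × InS 2 v × InS 2 w
                 × u ≢ v × v ≢ w × u ≢ w
                 × Adjacent u v × Adjacent v w × Adjacent u w

  In4 : Fin k → Fin k → Fin k → Fin k → Fin k → Set
  In4 x₀ x₁ x₂ x₃ x = x ≡ x₀ ⊎ x ≡ x₁ ⊎ x ≡ x₂ ⊎ x ≡ x₃

  IsSubgroupS1 : Fin k → Fin k → Fin k → Set
  IsSubgroupS1 p q r =
    (∀ x → In4 e p q r x → InS 1 x)
    × (∀ x y → In4 e p q r x → In4 e p q r y → ∃[ z ] (In4 e p q r z × ProdIs x y z))
    × (∀ x → In4 e p q r x → In4 e p q r (star x))

V4 : Set
V4 = Bool × Bool

_⊕_ : V4 → V4 → V4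
(a , b) ⊕ (a' , b') = (a xor a') , (b xor b')

module _ (S : Scheme) where
  open Scheme S

  IsoToKlein : Fin k → Fin k → Fin k → Set
  IsoToKlein p q r = Σ (V4 → Fin k) λ φ →
      (∀ g h → φ g ≡ φ h → g ≡ h)
    × (∀ g → In4 S e p q r (φ g))
    × (∀ x → In4 S e p q r x → ∃[ g ] φ g ≡ x)
    × (∀ g h → ProdIs S (φ g) (φ h) (φ (g ⊕ h)))

module Submission where

-- (⇒) p·q·r = 1_Ω says every p,q,r-path is closed.  From this, p, q, r are
--     thin, every product of two of them is the third, and each squares to
--     1_Ω; so 00 ↦ 1_Ω, 10 ↦ p, 01 ↦ q, 11 ↦ r is a homomorphism from V₄
--     with trivial kernel, whose image {1_Ω, p, q, r} is the subgroup.
-- (⇐) Transport along the isomorphism φ : V₄ → {1_Ω, p, q, r}.  Since an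
--     injection out of V₄ takes four values, p ≠ q; the element p·q lies in
--     {1_Ω, p, q, r} and is none of 1_Ω, p, q, so p·q = r; with r·r = 1_Ω this
--     gives p·q·r = 1_Ω.

open import Defs
open import Data.Nat using (zero; suc)
open import Data.Nat.Properties using (n<1+n; suc-injective; 1+n≢0)
open import Data.Bool using (Bool; true; false; T; _∧_)
open import Data.Bool.Properties using (T-≡; T-∧; xor-same; xor-assoc; xor-identityʳ)
open import Data.Fin using (Fin; zero; suc; _≟_)
open import Data.Fin.Properties using (<⇒notInjective; 0≢1+n) renaming (suc-injective to fsuc-injective)
open import Data.Product using (∃-syntax; _×_; _,_; proj₁; proj₂)
open import Data.Sum using (_⊎_; inj₁; inj₂)
open import Data.Empty using (⊥-elim)
open import Function using (_∘_)
open import Function.Bundles using (Equivalence)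
open import Relation.Nullary using (¬_; yes; no)
open import Relation.Nullary.Decidable using (⌊_⌋; toWitness; fromWitness)
open import Relation.Binary.PropositionalEquality

≟-sound : ∀ {m} {x y : Fin m} → T ⌊ x ≟ y ⌋ → x ≡ y
≟-sound {x = x} {y} = toWitness {a? = x ≟ y}

≟-complete : ∀ {m} {x y : Fin m} → x ≡ y → T ⌊ x ≟ y ⌋
≟-complete {x = x} {y} = fromWitness {a? = x ≟ y}

cnt-witness : ∀ {n} (P : Fin n → Bool) → cnt P ≢ 0 → ∃[ d ] T (P d)
cnt-witness {zero} P h = ⊥-elim (h refl)
cnt-witness {suc n} P h with P zero in eq
... | true = zero , Equivalence.from T-≡ eq
... | false = let (d , Pd) = cnt-witness (P ∘ suc) h in suc d , Pd

cnt-positive : ∀ {n} (P : Fin n → Bool) {d} → T (P d) → cnt P ≢ 0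
cnt-positive P {zero} Pd h with P zero
cnt-positive P {zero} Pd () | true
cnt-positive P {zero} () h | false
cnt-positive P {suc d} Pd h with P zero
cnt-positive P {suc d} Pd () | true
... | false = cnt-positive (P ∘ suc) Pd h

cnt-unique : ∀ {n} (P : Fin n → Bool) {a b} → cnt P ≡ 1 → T (P a) → T (P b) → a ≡ b
cnt-unique P {zero} {zero} _ _ _ = refl
cnt-unique P {zero} {suc b} h Pa Pb with P zero
... | true = ⊥-elim (cnt-positive (P ∘ suc) Pb (suc-injective h))
cnt-unique P {suc a} {zero} h Pa Pb with P zero
... | true = ⊥-elim (cnt-positive (P ∘ suc) Pa (suc-injective h))
cnt-unique P {suc a} {suc b} h Pa Pb with P zero
... | true = ⊥-elim (cnt-positive (P ∘ suc) Pa (suc-injective h))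
... | false = cong suc (cnt-unique (P ∘ suc) h Pa Pb)

cnt-none : ∀ {n} (P : Fin n → Bool) → (∀ b → ¬ T (P b)) → cnt P ≡ 0
cnt-none {zero} P none = refl
cnt-none {suc n} P none with P zero in eq
... | true = ⊥-elim (none zero (Equivalence.from T-≡ eq))
... | false = cnt-none (P ∘ suc) (none ∘ suc)

cnt-single : ∀ {n} (P : Fin n → Bool) {a} → T (P a) → (∀ b → T (P b) → b ≡ a) → cnt P ≡ 1
cnt-single P {zero} Pa only with P zero
... | true = cong suc (cnt-none (P ∘ suc) (λ b Pb → 0≢1+n (sym (only (suc b) Pb))))
cnt-single P {suc a} Pa only with P zero in eq
... | true = ⊥-elim (0≢1+n (only zero (Equivalence.from T-≡ eq)))
... | false = cnt-single (P ∘ suc) Pa (λ b Pb → fsuc-injective (only (suc b) Pb))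

cnt-two : ∀ {n} (P : Fin n → Bool) → cnt P ≡ 2 → ∃[ a ] ∃[ b ] (a ≢ b × T (P a) × T (P b))
cnt-two {suc n} P h with P zero in eq
... | true = let (d , Pd) = cnt-witness (P ∘ suc) (λ tail≡0 → 1+n≢0 (trans (sym (suc-injective h)) tail≡0))
             in zero , suc d , 0≢1+n , Equivalence.from T-≡ eq , Pd
... | false = let (a , b , a≢b , Pa , Pb) = cnt-two (P ∘ suc) h
              in suc a , suc b , a≢b ∘ fsuc-injective , Pa , Pb

0V : V4
0V = false , false

⊕-identityʳ : ∀ g → g ⊕ 0V ≡ g
⊕-identityʳ (a , b) = cong₂ _,_ (xor-identityʳ a) (xor-identityʳ b)

⊕-self : ∀ g → g ⊕ g ≡ 0V
⊕-self (a , b) = cong₂ _,_ (xor-same a) (xor-same b)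

⊕-assoc : ∀ g h k → (g ⊕ h) ⊕ k ≡ g ⊕ (h ⊕ k)
⊕-assoc (a , b) (a' , b') (a'' , b'') = cong₂ _,_ (xor-assoc a a' a'') (xor-assoc b b' b'')

⊕-cancelˡ : ∀ g h → g ⊕ (g ⊕ h) ≡ h
⊕-cancelˡ g h = begin
  g ⊕ (g ⊕ h)  ≡⟨ ⊕-assoc g g h ⟨
  (g ⊕ g) ⊕ h  ≡⟨ cong (_⊕ h) (⊕-self g) ⟩
  0V ⊕ h       ≡⟨⟩
  h            ∎
  where open ≡-Reasoning

⊕-cancelʳ : ∀ g h → (g ⊕ h) ⊕ h ≡ g
⊕-cancelʳ g h = begin
  (g ⊕ h) ⊕ h  ≡⟨ ⊕-assoc g h h ⟩
  g ⊕ (h ⊕ h)  ≡⟨ cong (g ⊕_) (⊕-self h) ⟩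
  g ⊕ 0V       ≡⟨ ⊕-identityʳ g ⟩
  g            ∎
  where open ≡-Reasoning

⊕≡0V : ∀ {g h} → g ⊕ h ≡ 0V → g ≡ h
⊕≡0V {g} {h} eq = trans (sym (⊕-identityʳ g)) (trans (cong (g ⊕_) (sym eq)) (⊕-cancelˡ g h))

⊕≡ˡ : ∀ {g h} → g ⊕ h ≡ g → h ≡ 0V
⊕≡ˡ {g} {h} eq = trans (sym (⊕-cancelˡ g h)) (trans (cong (g ⊕_) eq) (⊕-self g))

⊕≡ʳ : ∀ {g h} → g ⊕ h ≡ h → g ≡ 0V
⊕≡ʳ {g} {h} eq = trans (sym (⊕-cancelʳ g h)) (trans (cong (_⊕ h) eq) (⊕-self h))

enum : Fin 4 → V4
enum zero = false , false
enum (suc zero) = true , false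
enum (suc (suc zero)) = false , true
enum (suc (suc (suc zero))) = true , true

index : V4 → Fin 4
index (false , false) = zero
index (true , false) = suc zero
index (false , true) = suc (suc zero)
index (true , true) = suc (suc (suc zero))

index-enum : ∀ i → index (enum i) ≡ i
index-enum zero = refl
index-enum (suc zero) = refl
index-enum (suc (suc zero)) = refl
index-enum (suc (suc (suc zero))) = refl

V4-injection-four : ∀ {A : Set} (φ : V4 → A) → (∀ g h → φ g ≡ φ h → g ≡ h) →
                    (vals : Fin 3 → A) → ¬ (∀ g → ∃[ t ] vals t ≡ φ g)
V4-injection-four φ φ-inj vals cover = <⇒notInjective {f = tag} (n<1+n 3) tag-injective
  where
  tag : Fin 4 → Fin 3
  tag i = proj₁ (cover (enum i))

  tag-injective : ∀ {i j} → tag i ≡ tag j → i ≡ j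
  tag-injective {i} {j} eq = begin
    i                 ≡⟨ index-enum i ⟨
    index (enum i)    ≡⟨ cong index (φ-inj (enum i) (enum j) same-value) ⟩
    index (enum j)    ≡⟨ index-enum j ⟩
    j                 ∎
    where
    open ≡-Reasoning
    same-value : φ (enum i) ≡ φ (enum j)
    same-value = trans (sym (proj₂ (cover (enum i)))) (trans (cong vals eq) (proj₂ (cover (enum j))))

module SchemeTheory (S : Scheme) where
  open Scheme S

  Thin : Fin k → Set
  Thin x = ∀ {α β γ} → c α β ≡ x → c α γ ≡ x → β ≡ γ

  Sym : Fin k → Set
  Sym x = star x ≡ x

  diag-refl : ∀ α → c α α ≡ e
  diag-refl α = proj₂ (diag α α) refl

  diag-eq : ∀ {α β} → c α β ≡ e → α ≡ β
  diag-eq {α} {β} = proj₁ (diag α β)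

  star-intro : ∀ {x α β} → c α β ≡ x → c β α ≡ star x
  star-intro {x} {α} {β} = proj₁ (transp x α β)

  star-elim : ∀ {x α β} → c α β ≡ star x → c β α ≡ x
  star-elim {x} {α} {β} = proj₂ (transp x β α)

  symm : ∀ {x α β} → Sym x → c α β ≡ x → c β α ≡ x
  symm x-sym h = trans (star-intro h) x-sym

  -- A single path α –u→ δ –v→ γ puts the colour of (α, γ) into uv: by
  -- regularity every pair of that colour is joined by such a path.
  transfer : ∀ {u v α δ γ} → c α δ ≡ u → c δ γ ≡ v → InProd S u v (c α γ)
  transfer {u} {v} {α} {δ} {γ} αδ δγ β β' ββ' =
    let path-here = cnt-positive (λ d → ⌊ c α d ≟ u ⌋ ∧ ⌊ c d γ ≟ v ⌋)
                      (Equivalence.from T-∧ (≟-complete αδ , ≟-complete δγ))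
        counts = regular u v (c α γ) α γ β β' refl ββ'
        (d , Pd) = cnt-witness _ (path-here ∘ trans counts)
        (βd , dβ') = Equivalence.to T-∧ Pd
    in d , ≟-sound βd , ≟-sound dβ'

  successor : ∀ x α → ∃[ δ ] c α δ ≡ x
  successor x α =
    let (β , β' , ββ') = nonempty x
        (δ , αδ , _) = transfer ββ' (star-intro ββ') α α (trans (diag-refl α) (sym (diag-refl β)))
    in δ , αδ

  predecessor : ∀ x α → ∃[ δ ] c δ α ≡ x
  predecessor x α = let (δ , αδ) = successor (star x) α in δ , star-elim αδ

  S1⇒thin : ∀ {x} → InS S 1 x → Thin x
  S1⇒thin {x} x∈S₁ {α} αβ αγ = cnt-unique (λ δ → ⌊ c α δ ≟ x ⌋) (x∈S₁ α) (≟-complete αβ) (≟-complete αγ)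

  thin⇒S1 : ∀ {x} → Thin x → InS S 1 x
  thin⇒S1 {x} x-thin α =
    let (δ , αδ) = successor x α
    in cnt-single (λ δ → ⌊ c α δ ≟ x ⌋) (≟-complete αδ) (λ β αβ → x-thin (≟-sound αβ) αδ)

  point : Fin n
  point = proj₁ (nonempty e)

  e-sym : Sym e
  e-sym = trans (sym (star-intro (diag-refl point))) (diag-refl point)

  e-thin : Thin e
  e-thin αβ αγ = trans (sym (diag-eq αβ)) (diag-eq αγ)

  e-left : ∀ {x} → ProdIs S e x x
  e-left {x} α γ = to , from
    where
    to : ∃[ δ ] (c α δ ≡ e × c δ γ ≡ x) → c α γ ≡ x
    to (δ , αδ , δγ) = subst (λ β → c β γ ≡ x) (sym (diag-eq αδ)) δγ
    from : c α γ ≡ x → ∃[ δ ] (c α δ ≡ e × c δ γ ≡ x)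
    from αγ = α , diag-refl α , αγ

  e-right : ∀ {x} → ProdIs S x e x
  e-right {x} α γ = to , from
    where
    to : ∃[ δ ] (c α δ ≡ x × c δ γ ≡ e) → c α γ ≡ x
    to (δ , αδ , δγ) = subst (λ β → c α β ≡ x) (diag-eq δγ) αδ
    from : c α γ ≡ x → ∃[ δ ] (c α δ ≡ x × c δ γ ≡ e)
    from αγ = γ , αγ , diag-refl γ

  prod-unique : ∀ {x y z z'} → ProdIs S x y z → ProdIs S x y z' → z ≡ z'
  prod-unique {x} {y} xy=z xy=z' =
    let (δ , αδ) = successor x point
        (γ , δγ) = successor y δ
    in trans (sym (proj₁ (xy=z point γ) (δ , αδ , δγ))) (proj₁ (xy=z' point γ) (δ , αδ , δγ))

  square-id : ∀ {x} → Sym x → Thin x → ProdIs S x x e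
  square-id {x} x-sym x-thin α γ = to , from
    where
    to : ∃[ δ ] (c α δ ≡ x × c δ γ ≡ x) → c α γ ≡ e
    to (δ , αδ , δγ) = proj₂ (diag α γ) (x-thin (symm x-sym αδ) δγ)
    from : c α γ ≡ e → ∃[ δ ] (c α δ ≡ x × c δ γ ≡ x)
    from αγ with diag-eq αγ
    ... | refl = let (δ , αδ) = successor x α in δ , αδ , symm x-sym αδ

  idempotent-id : ∀ {x} → Thin x → ProdIs S x x x → x ≡ e
  idempotent-id {x} x-thin xx=x with nonempty x
  ... | α , β , αβ with proj₂ (xx=x α β) αβ
  ... | δ , αδ , δβ with x-thin αδ αβ
  ... | refl = trans (sym δβ) (diag-refl δ)

  -- A relation in S₂ cannot have unique predecessors: choosing a successor
  -- s α for every α gives an injection Ω → Ω missing a successor of some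
  -- point, i.e. an injection Fin (n + 1) → Fin n.
  S2-not-co-thin : ∀ {u} → InS S 2 u → ¬ (∀ {β β' δ} → c β δ ≡ u → c β' δ ≡ u → β ≡ β')
  S2-not-co-thin {u} u∈S₂ co-thin = <⇒notInjective {f = extend} (n<1+n n) extend-injective
    where
    s : Fin n → Fin n
    s α = proj₁ (successor u α)

    s-injective : ∀ {α α'} → s α ≡ s α' → α ≡ α'
    s-injective {α} {α'} eq =
      co-thin (proj₂ (successor u α)) (subst (λ δ → c α' δ ≡ u) (sym eq) (proj₂ (successor u α')))

    missed : ∃[ d ] (c point d ≡ u × s point ≢ d)
    missed with cnt-two (λ δ → ⌊ c point δ ≟ u ⌋) (u∈S₂ point)
    ... | a , b , a≢b , Pa , Pb with s point ≟ a
    ... | yes sa = b , ≟-sound Pb , λ sb → a≢b (trans (sym sa) sb)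
    ... | no ¬sa = a , ≟-sound Pa , ¬sa

    d = proj₁ missed

    d∉image : ∀ β → s β ≢ d
    d∉image β eq = proj₂ (proj₂ missed) (trans (cong s (sym β≡point)) eq)
      where
      β≡point : β ≡ point
      β≡point = co-thin (subst (λ δ → c β δ ≡ u) eq (proj₂ (successor u β))) (proj₁ (proj₂ missed))

    extend : Fin (suc n) → Fin n
    extend zero = d
    extend (suc i) = s i

    extend-injective : ∀ {i j} → extend i ≡ extend j → i ≡ j
    extend-injective {zero} {zero} _ = refl
    extend-injective {zero} {suc j} eq = ⊥-elim (d∉image j (sym eq))
    extend-injective {suc i} {zero} eq = ⊥-elim (d∉image i eq)
    extend-injective {suc i} {suc j} eq = cong suc (s-injective eq)

  module _ {u p : Fin k} (u∈S₂ : InS S 2 u) (u⊥p : IsPerp S u p) where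

    perp-path : ∀ {α α' δ} → c α δ ≡ u → c α' δ ≡ u → c α α' ≡ e ⊎ c α α' ≡ p
    perp-path {α} {α'} αδ α'δ = proj₁ (u⊥p (c α α')) (transfer αδ (star-intro α'δ))

    -- u⊥ ≠ 1_Ω, for otherwise predecessors along u would be unique.
    perp-nontrivial : p ≢ e
    perp-nontrivial p≡e = S2-not-co-thin u∈S₂ co-thin
      where
      co-thin : ∀ {β β' δ} → c β δ ≡ u → c β' δ ≡ u → β ≡ β'
      co-thin βδ β'δ with perp-path βδ β'δ
      ... | inj₁ ββ'=e = diag-eq ββ'=e
      ... | inj₂ ββ'=p = diag-eq (trans ββ'=p p≡e)

    -- u⊥ is symmetric: a p-pair consists of two u-predecessors of one point.
    perp-sym : Sym p
    perp-sym with nonempty p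
    ... | α , α' , αα' with proj₂ (u⊥p p) (inj₂ refl) α α' αα'
    ... | δ , αδ , δα' with perp-path (star-elim {u} δα') αδ
    ... | inj₁ α'α=e =
      ⊥-elim (perp-nontrivial (trans (sym αα') (subst (λ β → c α β ≡ e) (sym (diag-eq α'α=e)) (diag-refl α))))
    ... | inj₂ α'α=p = trans (sym (star-intro αα')) α'α=p

  Closed : Fin k → Fin k → Fin k → Set
  Closed x y z = ∀ {α δ ε γ} → c α δ ≡ x → c δ ε ≡ y → c ε γ ≡ z → α ≡ γ

  exceptional⇒closed : ∀ {x y z} → Prod3IsId S x y z → Closed x y z
  exceptional⇒closed x·y·z=1 {α} {δ} {ε} {γ} αδ δε εγ = proj₁ (x·y·z=1 α γ) (δ , ε , αδ , δε , εγ)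

  closed-reverse : ∀ {x y z} → Sym x → Sym y → Sym z → Closed x y z → Closed z y x
  closed-reverse x-sym y-sym z-sym closed αδ δε εγ =
    sym (closed (symm x-sym εγ) (symm y-sym δε) (symm z-sym αδ))

  -- The last step of a closed path is forced, so its relation is thin.
  closed-thin : ∀ {x y z} → Closed x y z → Thin z
  closed-thin {x} {y} closed {ε} εβ εγ =
    let (δ , δε) = predecessor y ε
        (α , αδ) = predecessor x δ
    in trans (sym (closed αδ δε εβ)) (closed αδ δε εγ)

  closed-rotate : ∀ {x y z} → Thin x → Closed x y z → Closed y z x
  closed-rotate {x} x-thin closed {δ} δε εγ γβ =
    let (α , αδ) = predecessor x δ
    in x-thin (subst (λ ζ → c ζ δ ≡ x) (closed αδ δε εγ) αδ) γβ

  closed-product : ∀ {x y z} → Sym z → Thin z → Closed x y z → ProdIs S x y z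
  closed-product {x} {y} {z} z-sym z-thin closed α γ = to , from
    where
    to : ∀ {α γ} → ∃[ δ ] (c α δ ≡ x × c δ γ ≡ y) → c α γ ≡ z
    to {α} {γ} (δ , αδ , δγ) =
      let (β , γβ) = successor z γ
      in symm z-sym (subst (λ ζ → c γ ζ ≡ z) (sym (closed αδ δγ γβ)) γβ)
    from : c α γ ≡ z → ∃[ δ ] (c α δ ≡ x × c δ γ ≡ y)
    from αγ =
      let (δ , αδ) = successor x α
          (ε , δε) = successor y δ
      in δ , αδ , subst (λ ζ → c δ ζ ≡ y) (z-thin (to (δ , αδ , δε)) αγ) δε

  product-exceptional : ∀ {x y z} → ProdIs S x y z → ProdIs S z z e → Thin z → Prod3IsId S x y z
  product-exceptional {x} {y} {z} xy=z zz=e z-thin α γ = to , from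
    where
    to : ∃[ δ ] ∃[ ε ] (c α δ ≡ x × c δ ε ≡ y × c ε γ ≡ z) → α ≡ γ
    to (δ , ε , αδ , δε , εγ) = diag-eq (proj₁ (zz=e α γ) (ε , proj₁ (xy=z α ε) (δ , αδ , δε) , εγ))
    from : α ≡ γ → ∃[ δ ] ∃[ ε ] (c α δ ≡ x × c δ ε ≡ y × c ε γ ≡ z)
    from refl with successor x α
    ... | δ , αδ with successor y δ
    ... | ε , δε with proj₂ (zz=e α α) (diag-refl α)
    ... | ε' , αε' , ε'α with z-thin αε' (proj₁ (xy=z α ε) (δ , αδ , δε))
    ... | refl = δ , ε' , αδ , δε , ε'α

  module KleinFromClosed {p q r : Fin k} (p-sym : Sym p) (q-sym : Sym q) (r-sym : Sym r)
                         (p≢e : p ≢ e) (q≢e : q ≢ e) (r≢e : r ≢ e) (pqr : Closed p q r) where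

    r-thin : Thin r
    r-thin = closed-thin pqr
    rqp : Closed r q p
    rqp = closed-reverse p-sym q-sym r-sym pqr
    p-thin : Thin p
    p-thin = closed-thin rqp
    qrp : Closed q r p
    qrp = closed-rotate p-thin pqr
    prq : Closed p r q
    prq = closed-reverse q-sym r-sym p-sym qrp
    q-thin : Thin q
    q-thin = closed-thin prq
    rpq : Closed r p q
    rpq = closed-rotate q-thin qrp
    qpr : Closed q p r
    qpr = closed-reverse r-sym p-sym q-sym rpq

    φ : V4 → Fin k
    φ (false , false) = e
    φ (true , false) = p
    φ (false , true) = q
    φ (true , true) = r

    φ-sym : ∀ g → Sym (φ g)
    φ-sym (false , false) = e-sym
    φ-sym (true , false) = p-sym
    φ-sym (false , true) = q-sym
    φ-sym (true , true) = r-sym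

    φ-thin : ∀ g → Thin (φ g)
    φ-thin (false , false) = e-thin
    φ-thin (true , false) = p-thin
    φ-thin (false , true) = q-thin
    φ-thin (true , true) = r-thin

    φ-hom : ∀ g h → ProdIs S (φ g) (φ h) (φ (g ⊕ h))
    φ-hom (false , false) h = e-left
    φ-hom (true , false) (false , false) = e-right
    φ-hom (false , true) (false , false) = e-right
    φ-hom (true , true) (false , false) = e-right
    φ-hom (true , false) (true , false) = square-id p-sym p-thin
    φ-hom (false , true) (false , true) = square-id q-sym q-thin
    φ-hom (true , true) (true , true) = square-id r-sym r-thin
    φ-hom (true , false) (false , true) = closed-product r-sym r-thin pqr
    φ-hom (false , true) (true , false) = closed-product r-sym r-thin qpr
    φ-hom (false , true) (true , true) = closed-product p-sym p-thin qrp
    φ-hom (true , true) (false , true) = closed-product p-sym p-thin rqp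
    φ-hom (true , true) (true , false) = closed-product q-sym q-thin rpq
    φ-hom (true , false) (true , true) = closed-product q-sym q-thin prq

    φ-kernel : ∀ g → φ g ≡ e → g ≡ 0V
    φ-kernel (false , false) _ = refl
    φ-kernel (true , false) p≡e = ⊥-elim (p≢e p≡e)
    φ-kernel (false , true) q≡e = ⊥-elim (q≢e q≡e)
    φ-kernel (true , true) r≡e = ⊥-elim (r≢e r≡e)

    -- trivial kernel: φ g = φ h forces φ (g ⊕ h) = φ h · φ h = 1_Ω
    φ-injective : ∀ g h → φ g ≡ φ h → g ≡ h
    φ-injective g h eq = ⊕≡0V (φ-kernel (g ⊕ h) (prod-unique (φ-hom g h) hh=e))
      where
      hh=e : ProdIs S (φ g) (φ h) e
      hh=e = subst (λ x → ProdIs S x (φ h) e) (sym eq) (square-id (φ-sym h) (φ-thin h))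

    φ-into : ∀ g → In4 S e p q r (φ g)
    φ-into (false , false) = inj₁ refl
    φ-into (true , false) = inj₂ (inj₁ refl)
    φ-into (false , true) = inj₂ (inj₂ (inj₁ refl))
    φ-into (true , true) = inj₂ (inj₂ (inj₂ refl))

    φ-onto : ∀ x → In4 S e p q r x → ∃[ g ] φ g ≡ x
    φ-onto x (inj₁ refl) = (false , false) , refl
    φ-onto x (inj₂ (inj₁ refl)) = (true , false) , refl
    φ-onto x (inj₂ (inj₂ (inj₁ refl))) = (false , true) , refl
    φ-onto x (inj₂ (inj₂ (inj₂ refl))) = (true , true) , refl

    subgroup : IsSubgroupS1 S p q r
    subgroup = in-S₁ , closed-under-product , closed-under-star
      where
      in-S₁ : ∀ x → In4 S e p q r x → InS S 1 x
      in-S₁ x x∈H = let (g , φg≡x) = φ-onto x x∈H in subst (InS S 1) φg≡x (thin⇒S1 (φ-thin g))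
      closed-under-product : ∀ x y → In4 S e p q r x → In4 S e p q r y →
                             ∃[ z ] (In4 S e p q r z × ProdIs S x y z)
      closed-under-product x y x∈H y∈H =
        let (g , φg≡x) = φ-onto x x∈H
            (h , φh≡y) = φ-onto y y∈H
        in φ (g ⊕ h) , φ-into (g ⊕ h) , subst₂ (λ a b → ProdIs S a b (φ (g ⊕ h))) φg≡x φh≡y (φ-hom g h)
      closed-under-star : ∀ x → In4 S e p q r x → In4 S e p q r (star x)
      closed-under-star x x∈H =
        let (g , φg≡x) = φ-onto x x∈H
        in subst (In4 S e p q r) (trans (sym (φ-sym g)) (cong star φg≡x)) (φ-into g)

    klein : IsoToKlein S p q r
    klein = φ , φ-injective , φ-into , φ-onto , φ-hom

  module ClosedFromKlein {p q r : Fin k} (p≢e : p ≢ e) (q≢e : q ≢ e)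
                         (H≤S₁ : IsSubgroupS1 S p q r) (iso : IsoToKlein S p q r) where

    φ : V4 → Fin k
    φ = proj₁ iso

    φ-injective : ∀ g h → φ g ≡ φ h → g ≡ h
    φ-injective = proj₁ (proj₂ iso)

    φ-into : ∀ g → In4 S e p q r (φ g)
    φ-into = proj₁ (proj₂ (proj₂ iso))

    φ-onto : ∀ x → In4 S e p q r x → ∃[ g ] φ g ≡ x
    φ-onto = proj₁ (proj₂ (proj₂ (proj₂ iso)))

    φ-hom : ∀ g h → ProdIs S (φ g) (φ h) (φ (g ⊕ h))
    φ-hom = proj₂ (proj₂ (proj₂ (proj₂ iso)))

    H-thin : ∀ {x} → In4 S e p q r x → Thin x
    H-thin x∈H = S1⇒thin (proj₁ H≤S₁ _ x∈H)

    -- φ 0 is a thin idempotent, hence 1_Ω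
    φ-zero : ∀ {g} → g ≡ 0V → φ g ≡ e
    φ-zero refl = idempotent-id (H-thin (φ-into 0V)) (φ-hom 0V 0V)

    r∈H : In4 S e p q r r
    r∈H = inj₂ (inj₂ (inj₂ refl))

    a b c' : V4
    a = proj₁ (φ-onto p (inj₂ (inj₁ refl)))
    b = proj₁ (φ-onto q (inj₂ (inj₂ (inj₁ refl))))
    c' = proj₁ (φ-onto r r∈H)

    φa≡p : φ a ≡ p
    φa≡p = proj₂ (φ-onto p (inj₂ (inj₁ refl)))

    φb≡q : φ b ≡ q
    φb≡q = proj₂ (φ-onto q (inj₂ (inj₂ (inj₁ refl))))

    φc'≡r : φ c' ≡ r
    φc'≡r = proj₂ (φ-onto r r∈H)

    -- p ≠ q, for otherwise the injection φ would take only the values 1_Ω, p, r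
    p≢q : p ≢ q
    p≢q p≡q = V4-injection-four φ φ-injective vals cover
      where
      vals : Fin 3 → Fin k
      vals zero = e
      vals (suc zero) = p
      vals (suc (suc zero)) = r
      cover : ∀ g → ∃[ t ] vals t ≡ φ g
      cover g with φ-into g
      ... | inj₁ φg≡e = zero , sym φg≡e
      ... | inj₂ (inj₁ φg≡p) = suc zero , sym φg≡p
      ... | inj₂ (inj₂ (inj₁ φg≡q)) = suc zero , trans p≡q (sym φg≡q)
      ... | inj₂ (inj₂ (inj₂ φg≡r)) = suc (suc zero) , sym φg≡r

    -- p·q = φ (a ⊕ b) lies in {1_Ω, p, q, r} and is none of 1_Ω, p, q
    φab≡r : φ (a ⊕ b) ≡ r
    φab≡r with φ-into (a ⊕ b)
    ... | inj₁ φab≡e =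
      let a≡b = ⊕≡0V (φ-injective (a ⊕ b) 0V (trans φab≡e (sym (φ-zero refl))))
      in ⊥-elim (p≢q (trans (sym φa≡p) (trans (cong φ a≡b) φb≡q)))
    ... | inj₂ (inj₁ φab≡p) =
      let b≡0 = ⊕≡ˡ (φ-injective (a ⊕ b) a (trans φab≡p (sym φa≡p)))
      in ⊥-elim (q≢e (trans (sym φb≡q) (φ-zero b≡0)))
    ... | inj₂ (inj₂ (inj₁ φab≡q)) =
      let a≡0 = ⊕≡ʳ (φ-injective (a ⊕ b) b (trans φab≡q (sym φb≡q)))
      in ⊥-elim (p≢e (trans (sym φa≡p) (φ-zero a≡0)))
    ... | inj₂ (inj₂ (inj₂ φab≡r)) = φab≡r

    pq=r : ProdIs S p q r
    pq=r = subst₂ (λ x y → ProdIs S x y r) φa≡p φb≡q (subst (ProdIs S (φ a) (φ b)) φab≡r (φ-hom a b))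

    rr=e : ProdIs S r r e
    rr=e = subst₂ (λ x y → ProdIs S x y e) φc'≡r φc'≡r
             (subst (ProdIs S (φ c') (φ c')) (φ-zero (⊕-self c')) (φ-hom c' c'))

    exceptional : Prod3IsId S p q r
    exceptional = product-exceptional pq=r rr=e (H-thin r∈H)

theorem7p2 : (S : Scheme) → QuasiThin S →
    (u v w p q r : Fin (Scheme.k S)) →
    Triangle S u v w →
    IsPerp S u p → IsPerp S v q → IsPerp S w r →
    (Prod3IsId S p q r → IsSubgroupS1 S p q r × IsoToKlein S p q r)
    × (IsSubgroupS1 S p q r × IsoToKlein S p q r → Prod3IsId S p q r)
theorem7p2 S _ u v w p q r (u∈S₂ , v∈S₂ , w∈S₂ , _) u⊥p v⊥q w⊥r =
  exceptional⇒klein , klein⇒exceptional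
  where
  open SchemeTheory S

  exceptional⇒klein : Prod3IsId S p q r → IsSubgroupS1 S p q r × IsoToKlein S p q r
  exceptional⇒klein p·q·r=1 = subgroup , klein
    where
    open KleinFromClosed (perp-sym u∈S₂ u⊥p) (perp-sym v∈S₂ v⊥q) (perp-sym w∈S₂ w⊥r)
                         (perp-nontrivial u∈S₂ u⊥p) (perp-nontrivial v∈S₂ v⊥q)
                         (perp-nontrivial w∈S₂ w⊥r) (exceptional⇒closed p·q·r=1)

  klein⇒exceptional : IsSubgroupS1 S p q r × IsoToKlein S p q r → Prod3IsId S p q r
  klein⇒exceptional (H≤S₁ , iso) =
    ClosedFromKlein.exceptional (perp-nontrivial u∈S₂ u⊥p) (perp-nontrivial v∈S₂ v⊥q) H≤S₁ iso
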